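{- Let $k\ge2$, let $\Gamma$ be a system as in the context, and let $H>0$. Then for every permutation $\sigma$ of $\{1,\dots,k-1\}$ (extended by $\sigma(0)=0$), $$M_\Gamma(H)\le\prod_{i=1}^{k-1}\Bigl(\frac{H}{\gamma_i^{(\sigma)}}+1\Bigr).$$
   Context: A system $\Gamma=\{\gamma_{i,j}:\ 0\le i\ne j\le k-1\}$ consists of positive squarefree integers with $\gamma_{i,j}=\gamma_{j,i}$ and $\gcd(\gamma_{i,j},\gamma_{j,l})\mid\gamma_{i,l}$ for all distinct $i,j,l$. Put $\gamma_j=\operatorname{lcm}_{0\le i\le j-1}\gamma_{i,j}$ ($1\le j\le k-1$), $\gamma(\Gamma)=\gamma_1\cdots\gamma_{k-1}$, and let $c=c(\Gamma)$ be the product of the distinct primes dividing $\gamma(\Gamma)$. For $\mathbf{h}=(h_1,\dots,h_{k-1})\in\mathbb{Z}^{k-1}$, with $h_0=0$ and $h_0,\dots,h_{k-1}$ distinct, let $\Gamma(\mathbf{h})=\{\gcd(c,h_j-h_i)\}_{0\le i\ne j\le k-1}$. Define $M_\Gamma(H)=\#\{(h_1,\dots,h_{k-1})\in\mathbb{Z}^{k-1}:\ h_0=0,\ h_i\ne h_j \text{ for } i\ne j,\ 0\le h_i\le H \text{ for all } i,\ \Gamma(\mathbf{h})=\Gamma\}$. For a permutation $\sigma$ with $\sigma(0)=0$, set $\gamma^{(\sigma)}_{i,j}=\gamma_{\sigma(i),\sigma(j)}$ and $\gamma^{(\sigma)}_i=\operatorname{lcm}_{0\le l\le i-1}\gamm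a^{(\sigma)}_{l,i}$.
   Formalization: The parameter H ranges over the positive rationals. -}

module Defs where

open import Data.Nat as ℕ using (ℕ; zero; suc; _*_; ∣_-_∣; _≡ᵇ_)
open import Data.Nat.Divisibility using (_∣_; _∣?_)
open import Data.Nat.GCD using (gcd)
open import Data.Nat.LCM using (lcm)
open import Data.Nat.Primality using (Prime; prime?)
open import Data.Fin as Fin using (Fin; toℕ)
open import Data.Fin.Permutation using (Permutation′; _⟨$⟩ʳ_)
open import Data.Bool using (Bool; true; false; _∧_; not)
open import Data.List using (List; []; _∷_; [_]; map; filter; foldr; upTo; concatMap; allFin; length)
open import Data.Nat.ListAction using (product)
open import Data.Bool.ListAction using (and)
open import Data.Vec as Vec using (Vec)
open import Data.Product using (_×_)
open import Relation.Nullary using (¬_; does)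
open import Relation.Nullary.Decidable using (_×-dec_; ¬?)
open import Relation.Binary.PropositionalEquality using (_≡_; _≢_)
open import Data.Integer as ℤ using (+_)
open import Data.Rational as ℚ using (ℚ; ↥_; _≤?_; _/_)

SquareFree : ℕ → Set
SquareFree n = ∀ p → Prime p → ¬ (p * p ∣ n)

-- A system Γ = {γ_{i,j}} on indices 0..k-1 (diagonal values are irrelevant)
IsSystem : (k : ℕ) → (Fin k → Fin k → ℕ) → Set
IsSystem k Γ =
  (∀ i j → i ≢ j → 0 ℕ.< Γ i j × SquareFree (Γ i j)) ×
  (∀ i j → i ≢ j → Γ i j ≡ Γ j i) ×
  (∀ i j l → i ≢ j → j ≢ l → i ≢ l → gcd (Γ i j) (Γ j l) ∣ Γ i l)

lcmList : List ℕ → ℕ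
lcmList = foldr lcm 1

gammaIdx : {k : ℕ} → (Fin k → Fin k → ℕ) → Fin k → ℕ
gammaIdx {k} Γ j = lcmList (map (λ i → Γ i j) (filter (λ i → i Fin.<? j) (allFin k)))

posIdx : (k : ℕ) → List (Fin k)
posIdx k = filter (λ i → ¬? (toℕ i ℕ.≟ 0)) (allFin k)

gammaTotal : {k : ℕ} → (Fin k → Fin k → ℕ) → ℕ
gammaTotal {k} Γ = product (map (gammaIdx Γ) (posIdx k))

rad : ℕ → ℕ
rad n = product (filter (λ p → prime? p ×-dec (p ∣? n)) (upTo (suc n)))

cOf : {k : ℕ} → (Fin k → Fin k → ℕ) → ℕ
cOf Γ = rad (gammaTotal Γ)

allTuples : (n N : ℕ) → List (Vec ℕ n)
allTuples zero N = [ Vec.[] ]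
allTuples (suc n) N = concatMap (λ x → map (x Vec.∷_) (allTuples n N)) (upTo (suc N))

admissible : {k : ℕ} → (Fin k → Fin k → ℕ) → ℚ → (Fin k → ℕ) → Bool
admissible {k} Γ H h =
  and (map (λ i → not (does (toℕ i ℕ.≟ 0)) Data.Bool.∨ (h i ≡ᵇ 0)) (allFin k)) ∧
  and (map (λ i → does ((+ h i) / 1 ≤? H)) (allFin k)) ∧
  and (concatMap (λ i → map (λ j →
        does (i Fin.≟ j) Data.Bool.∨
        (not (h i ≡ᵇ h j) ∧ (gcd (cOf Γ) ∣ h j - h i ∣ ≡ᵇ Γ i j)))
      (allFin k)) (allFin k))

-- M_Γ(H): h_i ∈ ℕ with h_i ≤ H ≤ |numerator H|, so enumerating {0..|↥H|}^k suffices
-- (a tuple h : Fin k → ℕ with h_0 = 0 corresponds exactly to (h_1,…,h_{k-1}))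
M : {k : ℕ} → (Fin k → Fin k → ℕ) → ℚ → ℕ
M {k} Γ H = length (filter (λ v → admissible Γ H (Vec.lookup v) Data.Bool.≟ true)
                           (allTuples k (ℤ.∣ ↥ H ∣)))

FixesZero : {k : ℕ} → Permutation′ k → Set
FixesZero {k} σ = ∀ i → toℕ i ≡ 0 → toℕ (σ ⟨$⟩ʳ i) ≡ 0

permSys : {k : ℕ} → Permutation′ k → (Fin k → Fin k → ℕ) → Fin k → Fin k → ℕ
permSys σ Γ i j = Γ (σ ⟨$⟩ʳ i) (σ ⟨$⟩ʳ j)

-- H / n for a positive natural n (value at n = 0 is an unused junk value)
divℕ : ℚ → ℕ → ℚ
divℕ H zero = ℚ.0ℚ
divℕ H (suc n) = H ℚ.* (+ 1 / suc n)

bound : {k : ℕ} → Permutation′ k → (Fin k → Fin k → ℕ) → ℚ → ℚ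
bound {k} σ Γ H =
  foldr ℚ._*_ ℚ.1ℚ (map (λ i → divℕ H (gammaIdx (permSys σ Γ) i) ℚ.+ ℚ.1ℚ) (posIdx k))

-- Order the indices by σ.  If l < i then γ_{σ(l),σ(i)} divides h_{σ(i)} − h_{σ(l)}, so the values
-- h_{σ(l)} for l < i fix h_{σ(i)} modulo their lcm γ^{(σ)}_i; the quotient ⌊h_{σ(i)} / γ^{(σ)}_i⌋
-- then fixes h_{σ(i)} itself.  Hence h ↦ (⌊h_{σ(i)} / γ^{(σ)}_i⌋)_{i ≥ 1} is injective on the tuples
-- counted by M_Γ(H), and it lands in a box with ⌊H / γ^{(σ)}_i⌋ + 1 ≤ H / γ^{(σ)}_i + 1 values in
-- coordinate i.

module Submission where

open import Defs
open import Data.Bool using (Bool; T; true; not; _∧_; _∨_)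
open import Data.Bool.Properties using (T-∧; T-∨; T-≡)
open import Data.Bool.ListAction using (and; all)
open import Data.Empty using (⊥-elim)
open import Data.Fin as Fin using (Fin; zero; suc; toℕ)
open import Data.Fin.Induction using (<-wellFounded)
open import Data.Fin.Permutation using (Permutation′; _⟨$⟩ʳ_; _⟨$⟩ˡ_; inverseˡ; inverseʳ)
open import Data.Fin.Properties using (injective⇒≤; <⇒≢)
open import Data.Integer as ℤ using (+_)
import Data.Integer.Properties as ℤ
open import Data.List
  using (List; []; _∷_; [_]; _++_; map; foldr; filter; concatMap; cartesianProductWith; upTo; allFin; length; lookup)
open import Data.List.Properties
  using (length-++; length-map; length-upTo; ∷-injectiveˡ; ∷-injectiveʳ; map-id; map-∘)
open import Data.List.Membership.Propositional using (_∈_)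
open import Data.List.Membership.Propositional.Properties
  using (∈-lookup; ∈-upTo⁺; ∈-upTo⁻; ∈-allFin; ∈-filter⁺; ∈-filter⁻;
         ∈-cartesianProductWith⁺; ∈-cartesianProductWith⁻)
import Data.List.Membership.Setoid.Properties as Membershipₛ
open import Data.List.Relation.Unary.Any as Any using (here; there)
open import Data.List.Relation.Unary.All as All using (All; []; _∷_)
open import Data.List.Relation.Unary.All.Properties using (all⁺; all-filter; concat⁻; map⁺; map⁻)
open import Data.List.Relation.Unary.Unique.Propositional using (Unique; []; _∷_)
import Data.List.Relation.Unary.Unique.Propositional.Properties as Unique
open import Data.Nat as ℕ
  using (ℕ; zero; suc; _+_; _*_; _∸_; _≤_; z≤n; s≤s; ∣_-_∣; _/_; _%_; _≡ᵇ_;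
         NonZero; >-nonZero; ≢-nonZero; ≢-nonZero⁻¹)
import Data.Nat
open import Data.Nat.Properties
  using (≤-total; ≤-pred; m≤n⇒m<n∨m≡n; m+[n∸m]≡n; m≤n⇒∣n-m∣≡n∸m; ∣-∣-comm; [m+n]∸[m+o]≡n∸o;
         *-distribʳ-∸; *-identityˡ; m*n≢0; ≡ᵇ⇒≡; module ≤-Reasoning)
open import Data.Nat.DivMod using (m≡m%n+[m/n]*n; %-remove-+ʳ; m/n*n≤m; /-monoˡ-≤; /-congˡ)
open import Data.Nat.Divisibility using (_∣_; divides; 1∣_; 0∣⇒≡0; m∣m*n; n∣m*n)
open import Data.Nat.GCD using (gcd; gcd[m,n]∣n)
open import Data.Nat.LCM using (lcm; lcm-least)
open import Data.Nat.ListAction using (product)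
open import Data.Product using (_×_; _,_; proj₁; proj₂)
open import Data.Rational as ℚ using (ℚ; 0ℚ; 1ℚ; _<_; ↥_; toℚᵘ)
import Data.Rational
import Data.Rational.Properties as ℚ
open import Data.Rational.Unnormalised as ℚᵘ using (mkℚᵘ; *≡*; *≤*) renaming (_≃_ to _≃ᵘ_)
import Data.Rational.Unnormalised.Properties as ℚᵘ
open import Data.Sum using (inj₁; inj₂)
open import Data.Vec as Vec using (Vec)
open import Data.Vec.Properties using (∷-injective)
open import Data.Vec.Relation.Binary.Pointwise.Extensional using (ext; Pointwise-≡⇒≡)
open import Function using (_∘_; id; Equivalence)
import Induction.WellFounded as WF
open import Level using (0ℓ)
open import Relation.Nullary using (Dec; yes; no; ¬_; ¬?; does)
open import Relation.Unary using (Pred; Decidable)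
open import Relation.Binary.PropositionalEquality hiding ([_])

toℚ : ℕ → ℚ
toℚ n = + n ℚ./ 1

toℚᵘ-toℚ : ∀ n → toℚᵘ (toℚ n) ≃ᵘ mkℚᵘ (+ n) 0
toℚᵘ-toℚ n = ℚ.toℚᵘ-fromℚᵘ (mkℚᵘ (+ n) 0)

toℚ-+ : ∀ m n → toℚ (m + n) ≡ toℚ m ℚ.+ toℚ n
toℚ-+ m n = ℚ.toℚᵘ-injective (begin
  toℚᵘ (toℚ (m + n))              ≈⟨ toℚᵘ-toℚ (m + n) ⟩
  mkℚᵘ (+ (m + n)) 0              ≈⟨ *≡* (cong (ℤ._* + 1) numerators) ⟩
  mkℚᵘ (+ m) 0 ℚᵘ.+ mkℚᵘ (+ n) 0  ≈⟨ ℚᵘ.+-cong (toℚᵘ-toℚ m) (toℚᵘ-toℚ n) ⟨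
  toℚᵘ (toℚ m) ℚᵘ.+ toℚᵘ (toℚ n)  ≈⟨ ℚ.toℚᵘ-homo-+ (toℚ m) (toℚ n) ⟨
  toℚᵘ (toℚ m ℚ.+ toℚ n)          ∎)
  where
  open ℚᵘ.≃-Reasoning
  numerators : + (m + n) ≡ + m ℤ.* + 1 ℤ.+ + n ℤ.* + 1
  numerators = trans (ℤ.pos-+ m n) (sym (cong₂ ℤ._+_ (ℤ.*-identityʳ (+ m)) (ℤ.*-identityʳ (+ n))))

toℚ-* : ∀ m n → toℚ (m * n) ≡ toℚ m ℚ.* toℚ n
toℚ-* m n = ℚ.toℚᵘ-injective (begin
  toℚᵘ (toℚ (m * n))              ≈⟨ toℚᵘ-toℚ (m * n) ⟩
  mkℚᵘ (+ (m * n)) 0              ≈⟨ *≡* (cong (ℤ._* + 1) (ℤ.pos-* m n)) ⟩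
  mkℚᵘ (+ m) 0 ℚᵘ.* mkℚᵘ (+ n) 0  ≈⟨ ℚᵘ.*-cong (toℚᵘ-toℚ m) (toℚᵘ-toℚ n) ⟨
  toℚᵘ (toℚ m) ℚᵘ.* toℚᵘ (toℚ n)  ≈⟨ ℚ.toℚᵘ-homo-* (toℚ m) (toℚ n) ⟨
  toℚᵘ (toℚ m ℚ.* toℚ n)          ∎)
  where open ℚᵘ.≃-Reasoning

toℚ-mono-≤ : ∀ {m n} → m ℕ.≤ n → toℚ m ℚ.≤ toℚ n
toℚ-mono-≤ {m} {n} m≤n = ℚ.toℚᵘ-cancel-≤ (begin
  toℚᵘ (toℚ m)  ≃⟨ toℚᵘ-toℚ m ⟩
  mkℚᵘ (+ m) 0  ≤⟨ *≤* (ℤ.*-monoʳ-≤-nonNeg (+ 1) (ℤ.+≤+ m≤n)) ⟩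
  mkℚᵘ (+ n) 0  ≃⟨ toℚᵘ-toℚ n ⟨
  toℚᵘ (toℚ n)  ∎)
  where open ℚᵘ.≤-Reasoning

toℚ-nonNeg : ∀ n → ℚ.NonNegative (toℚ n)
toℚ-nonNeg n = ℚ.nonNegative (toℚ-mono-≤ {0} {n} z≤n)

toℚ[n]*[1/n]≡1 : ∀ n .{{_ : NonZero n}} → toℚ n ℚ.* (+ 1 ℚ./ n) ≡ 1ℚ
toℚ[n]*[1/n]≡1 (suc n) = ℚ.toℚᵘ-injective (begin
  toℚᵘ (toℚ (suc n) ℚ.* (+ 1 ℚ./ suc n))       ≈⟨ ℚ.toℚᵘ-homo-* (toℚ (suc n)) (+ 1 ℚ./ suc n) ⟩
  toℚᵘ (toℚ (suc n)) ℚᵘ.* toℚᵘ (+ 1 ℚ./ suc n)  ≈⟨ ℚᵘ.*-cong (toℚᵘ-toℚ (suc n)) (ℚ.toℚᵘ-fromℚᵘ (mkℚᵘ (+ 1) n)) ⟩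
  mkℚᵘ (+ suc n) 0 ℚᵘ.* mkℚᵘ (+ 1) n           ≈⟨ *≡* cross-multiplied ⟩
  ℚᵘ.1ℚᵘ                                       ∎)
  where
  open ℚᵘ.≃-Reasoning
  cross-multiplied : (+ suc n ℤ.* + 1) ℤ.* + 1 ≡ + 1 ℤ.* + (1 * suc n)
  cross-multiplied = trans (ℤ.*-identityʳ _) (trans (ℤ.*-identityʳ (+ suc n))
                       (sym (trans (ℤ.*-identityˡ _) (cong +_ (*-identityˡ (suc n))))))

divℕ-monoˡ-≤ : ∀ {p q} n → p ℚ.≤ q → divℕ p n ℚ.≤ divℕ q n
divℕ-monoˡ-≤ zero    p≤q = ℚ.≤-refl
divℕ-monoˡ-≤ (suc n) p≤q = ℚ.*-monoʳ-≤-nonNeg (+ 1 ℚ./ suc n) {{ℚ.normalize-nonNeg 1 (suc n)}} p≤q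

toℚ-/-≤ : ∀ m n .{{_ : NonZero n}} → toℚ (m / n) ℚ.≤ divℕ (toℚ m) n
toℚ-/-≤ m (suc n) = begin
  toℚ q                                         ≡⟨ ℚ.*-identityʳ (toℚ q) ⟨
  toℚ q ℚ.* 1ℚ                                  ≡⟨ cong (toℚ q ℚ.*_) (toℚ[n]*[1/n]≡1 (suc n)) ⟨
  toℚ q ℚ.* (toℚ (suc n) ℚ.* (+ 1 ℚ./ suc n))  ≡⟨ ℚ.*-assoc (toℚ q) (toℚ (suc n)) (+ 1 ℚ./ suc n) ⟨
  toℚ q ℚ.* toℚ (suc n) ℚ.* (+ 1 ℚ./ suc n)    ≡⟨ cong (ℚ._* (+ 1 ℚ./ suc n)) (toℚ-* q (suc n)) ⟨
  divℕ (toℚ (q * suc n)) (suc n)                ≤⟨ divℕ-monoˡ-≤ (suc n) (toℚ-mono-≤ (m/n*n≤m m (suc n))) ⟩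
  divℕ (toℚ m) (suc n)                          ∎
  where
  open ℚ.≤-Reasoning
  q = m / suc n

toℚ[1+m/n]≤divℕ+1 : ∀ {m p} n .{{_ : NonZero n}} → toℚ m ℚ.≤ p → toℚ (suc (m / n)) ℚ.≤ divℕ p n ℚ.+ 1ℚ
toℚ[1+m/n]≤divℕ+1 {m} {p} n m≤p = begin
  toℚ (1 + m / n)            ≡⟨ toℚ-+ 1 (m / n) ⟩
  1ℚ ℚ.+ toℚ (m / n)         ≡⟨ ℚ.+-comm 1ℚ (toℚ (m / n)) ⟩
  toℚ (m / n) ℚ.+ 1ℚ         ≤⟨ ℚ.+-monoˡ-≤ 1ℚ (ℚ.≤-trans (toℚ-/-≤ m n) (divℕ-monoˡ-≤ n m≤p)) ⟩
  divℕ p n ℚ.+ 1ℚ            ∎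
  where open ℚ.≤-Reasoning

toℚ-product-≤ : ∀ {A : Set} (f : A → ℕ) (g : A → ℚ) → (∀ x → toℚ (f x) ℚ.≤ g x) →
                ∀ xs → toℚ (product (map f xs)) ℚ.≤ foldr ℚ._*_ 1ℚ (map g xs)
toℚ-product-≤ f g f≤g []       = ℚ.≤-refl
toℚ-product-≤ f g f≤g (x ∷ xs) = begin
  toℚ (f x * product (map f xs))          ≡⟨ toℚ-* (f x) (product (map f xs)) ⟩
  toℚ (f x) ℚ.* toℚ (product (map f xs))  ≤⟨ ℚ.*-monoʳ-≤-nonNeg _ {{toℚ-nonNeg (product (map f xs))}} (f≤g x) ⟩
  g x ℚ.* toℚ (product (map f xs))        ≤⟨ ℚ.*-monoˡ-≤-nonNeg (g x) {{g-nonNeg}} (toℚ-product-≤ f g f≤g xs) ⟩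
  g x ℚ.* foldr ℚ._*_ 1ℚ (map g xs)       ∎
  where
  open ℚ.≤-Reasoning
  g-nonNeg : ℚ.NonNegative (g x)
  g-nonNeg = ℚ.nonNegative (ℚ.≤-trans (toℚ-mono-≤ {0} {f x} z≤n) (f≤g x))

≤⇒∣∣m-n∣⇒m%d≡n%d : ∀ {m n} d .{{_ : NonZero d}} → n ≤ m → d ∣ ∣ m - n ∣ → m % d ≡ n % d
≤⇒∣∣m-n∣⇒m%d≡n%d {m} {n} d n≤m d∣m-n = begin
  m % d             ≡⟨ cong (_% d) (m+[n∸m]≡n n≤m) ⟨
  (n + (m ∸ n)) % d ≡⟨ %-remove-+ʳ n (subst (d ∣_) (m≤n⇒∣n-m∣≡n∸m n≤m) d∣m-n) ⟩
  n % d             ∎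
  where open ≡-Reasoning

∣∣m-n∣⇒m%d≡n%d : ∀ {m n} d .{{_ : NonZero d}} → d ∣ ∣ m - n ∣ → m % d ≡ n % d
∣∣m-n∣⇒m%d≡n%d {m} {n} d d∣m-n with ≤-total n m
... | inj₁ n≤m = ≤⇒∣∣m-n∣⇒m%d≡n%d d n≤m d∣m-n
... | inj₂ m≤n = sym (≤⇒∣∣m-n∣⇒m%d≡n%d d m≤n (subst (d ∣_) (∣-∣-comm m n) d∣m-n))

≤⇒m%d≡n%d⇒∣∣m-n∣ : ∀ {m n} d .{{_ : NonZero d}} → n ≤ m → m % d ≡ n % d → d ∣ ∣ m - n ∣
≤⇒m%d≡n%d⇒∣∣m-n∣ {m} {n} d n≤m eq = divides (m / d ∸ n / d) (begin
  ∣ m - n ∣                                 ≡⟨ m≤n⇒∣n-m∣≡n∸m n≤m ⟩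
  m ∸ n                                     ≡⟨ cong₂ _∸_ (m≡m%n+[m/n]*n m d) (m≡m%n+[m/n]*n n d) ⟩
  (m % d + m / d * d) ∸ (n % d + n / d * d) ≡⟨ cong (λ r → (r + m / d * d) ∸ (n % d + n / d * d)) eq ⟩
  (n % d + m / d * d) ∸ (n % d + n / d * d) ≡⟨ [m+n]∸[m+o]≡n∸o (n % d) (m / d * d) (n / d * d) ⟩
  m / d * d ∸ n / d * d                     ≡⟨ *-distribʳ-∸ d (m / d) (n / d) ⟨
  (m / d ∸ n / d) * d                       ∎)
  where open ≡-Reasoning

m%d≡n%d⇒∣∣m-n∣ : ∀ {m n} d .{{_ : NonZero d}} → m % d ≡ n % d → d ∣ ∣ m - n ∣
m%d≡n%d⇒∣∣m-n∣ {m} {n} d eq with ≤-total n m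
... | inj₁ n≤m = ≤⇒m%d≡n%d⇒∣∣m-n∣ d n≤m eq
... | inj₂ m≤n = subst (d ∣_) (∣-∣-comm n m) (≤⇒m%d≡n%d⇒∣∣m-n∣ d m≤n (sym eq))

m%d≡n%d⇒m/d≡n/d⇒m≡n : ∀ {m n} d .{{_ : NonZero d}} → m % d ≡ n % d → m / d ≡ n / d → m ≡ n
m%d≡n%d⇒m/d≡n/d⇒m≡n {m} {n} d %-eq /-eq = begin
  m                 ≡⟨ m≡m%n+[m/n]*n m d ⟩
  m % d + m / d * d ≡⟨ cong₂ (λ r q → r + q * d) %-eq /-eq ⟩
  n % d + n / d * d ≡⟨ m≡m%n+[m/n]*n n d ⟨
  n                 ∎
  where open ≡-Reasoning

lcm-nonZero : ∀ m n .{{_ : NonZero m}} .{{_ : NonZero n}} → NonZero (lcm m n)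
lcm-nonZero m n = ≢-nonZero λ lcm≡0 →
  ≢-nonZero⁻¹ (m * n) {{m*n≢0 m n}} (0∣⇒≡0 (subst (_∣ m * n) lcm≡0 (lcm-least (m∣m*n {m} n) (n∣m*n m {n}))))

lcmList-nonZero : ∀ {xs} → All NonZero xs → NonZero (lcmList xs)
lcmList-nonZero []         = _
lcmList-nonZero (nz ∷ nzs) = lcm-nonZero _ _ {{nz}} {{lcmList-nonZero nzs}}

lcmList-least : ∀ {xs d} → All (_∣ d) xs → lcmList xs ∣ d
lcmList-least []           = 1∣ _
lcmList-least (x∣d ∷ xs∣d) = lcm-least x∣d (lcmList-least xs∣d)

module _ {k} (Γ : Fin k → Fin k → ℕ) (j : Fin k) where

  gammaIdx-nonZero : (∀ {i} → i Fin.< j → NonZero (Γ i j)) → NonZero (gammaIdx Γ j)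
  gammaIdx-nonZero nz = lcmList-nonZero (map⁺ (All.map nz (all-filter (Fin._<? j) (allFin k))))

  gammaIdx-least : ∀ {d} → (∀ {i} → i Fin.< j → Γ i j ∣ d) → gammaIdx Γ j ∣ d
  gammaIdx-least ∣d = lcmList-least (map⁺ (All.map ∣d (all-filter (Fin._<? j) (allFin k))))

Compatible : ∀ {k} → (Fin k → Fin k → ℕ) → (Fin k → ℕ) → Set
Compatible Γ h = ∀ {i j} → i Fin.< j → Γ i j ∣ ∣ h j - h i ∣

module _ {k} (Γ : Fin k → Fin k → ℕ) (Γ-nonZero : ∀ {i j} → i Fin.< j → NonZero (Γ i j)) where

  private instance
    gammaIdx-nz : ∀ {j} → NonZero (gammaIdx Γ j)
    gammaIdx-nz {j} = gammaIdx-nonZero Γ j Γ-nonZero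

  compatible-≡-by-quotients : ∀ {h h'} → Compatible Γ h → Compatible Γ h' →
    (∀ i → h i / gammaIdx Γ i ≡ h' i / gammaIdx Γ i) → ∀ i → h i ≡ h' i
  compatible-≡-by-quotients {h} {h'} h-compat h'-compat /-eq =
    WF.All.wfRec <-wellFounded 0ℓ (λ i → h i ≡ h' i) step
    where
    step : ∀ i → (∀ {l} → l Fin.< i → h l ≡ h' l) → h i ≡ h' i
    step i ih = m%d≡n%d⇒m/d≡n/d⇒m≡n (gammaIdx Γ i)
      (∣∣m-n∣⇒m%d≡n%d (gammaIdx Γ i) (gammaIdx-least Γ i Γ[l,i]∣h[i]-h'[i]))
      (/-eq i)
      where
      Γ[l,i]∣h[i]-h'[i] : ∀ {l} → l Fin.< i → Γ l i ∣ ∣ h i - h' i ∣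
      Γ[l,i]∣h[i]-h'[i] {l} l<i = m%d≡n%d⇒∣∣m-n∣ (Γ l i) (begin
        h i % Γ l i   ≡⟨ ∣∣m-n∣⇒m%d≡n%d (Γ l i) (h-compat l<i) ⟩
        h l % Γ l i   ≡⟨ cong (_% Γ l i) (ih l<i) ⟩
        h' l % Γ l i  ≡⟨ ∣∣m-n∣⇒m%d≡n%d (Γ l i) (h'-compat l<i) ⟨
        h' i % Γ l i  ∎)
        where
        open ≡-Reasoning
        instance _ = Γ-nonZero l<i

Unique⇒lookup-injective : ∀ {A : Set} {xs : List A} → Unique xs → ∀ {i j} → lookup xs i ≡ lookup xs j → i ≡ j
Unique⇒lookup-injective (x∉xs ∷ u) {zero}  {zero}  eq = refl
Unique⇒lookup-injective (x∉xs ∷ u) {zero}  {suc j} eq = ⊥-elim (All.lookup x∉xs (∈-lookup j) eq)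
Unique⇒lookup-injective (x∉xs ∷ u) {suc i} {zero}  eq = ⊥-elim (All.lookup x∉xs (∈-lookup i) (sym eq))
Unique⇒lookup-injective (x∉xs ∷ u) {suc i} {suc j} eq = cong suc (Unique⇒lookup-injective u eq)

length-≤-injectiveOn : ∀ {A B : Set} {xs : List A} {ys : List B} (f : A → B) → Unique xs →
  (∀ {x} → x ∈ xs → f x ∈ ys) → (∀ {x y} → x ∈ xs → y ∈ xs → f x ≡ f y → x ≡ y) →
  length xs ≤ length ys
length-≤-injectiveOn {xs = xs} f xs-unique f∈ys f-injective = injective⇒≤ index∘f-injective
  where
  index∘f-injective : ∀ {i j} → Any.index (f∈ys (∈-lookup i)) ≡ Any.index (f∈ys (∈-lookup j)) → i ≡ j
  index∘f-injective {i} {j} eq = Unique⇒lookup-injective xs-unique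
    (f-injective (∈-lookup i) (∈-lookup j)
      (Membershipₛ.index-injective (setoid _) (f∈ys (∈-lookup i)) (f∈ys (∈-lookup j)) eq))

map≡map⇒≡ : ∀ {A B : Set} {f g : A → B} {xs} → map f xs ≡ map g xs → ∀ {x} → x ∈ xs → f x ≡ g x
map≡map⇒≡ {xs = x ∷ xs} eq (here refl) = ∷-injectiveˡ eq
map≡map⇒≡ {xs = x ∷ xs} eq (there x∈xs) = map≡map⇒≡ (∷-injectiveʳ eq) x∈xs

concatMap-map≡cartesianProductWith : ∀ {A B C : Set} (f : A → B → C) xs ys →
  concatMap (λ x → map (f x) ys) xs ≡ cartesianProductWith f xs ys
concatMap-map≡cartesianProductWith f []       ys = refl
concatMap-map≡cartesianProductWith f (x ∷ xs) ys =
  cong (map (f x) ys ++_) (concatMap-map≡cartesianProductWith f xs ys)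

length-cartesianProductWith : ∀ {A B C : Set} (f : A → B → C) xs ys →
  length (cartesianProductWith f xs ys) ≡ length xs * length ys
length-cartesianProductWith f []       ys = refl
length-cartesianProductWith f (x ∷ xs) ys = begin
  length (map (f x) ys ++ cartesianProductWith f xs ys)          ≡⟨ length-++ (map (f x) ys) ⟩
  length (map (f x) ys) + length (cartesianProductWith f xs ys)  ≡⟨ cong₂ _+_ (length-map (f x) ys)
                                                                              (length-cartesianProductWith f xs ys) ⟩
  length ys + length xs * length ys                              ∎
  where open ≡-Reasoning

boxes : List ℕ → List (List ℕ)
boxes []       = [ [] ]
boxes (b ∷ bs) = cartesianProductWith _∷_ (upTo (suc b)) (boxes bs)

length-boxes : ∀ bs → length (boxes bs) ≡ product (map suc bs)
length-boxes []       = refl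
length-boxes (b ∷ bs) = trans (length-cartesianProductWith _∷_ (upTo (suc b)) (boxes bs))
  (cong₂ _*_ (length-upTo (suc b)) (length-boxes bs))

map∈boxes : ∀ {A : Set} (f g : A → ℕ) → (∀ x → f x ≤ g x) → ∀ xs → map f xs ∈ boxes (map g xs)
map∈boxes f g f≤g []       = here refl
map∈boxes f g f≤g (x ∷ xs) = ∈-cartesianProductWith⁺ _∷_ (∈-upTo⁺ (s≤s (f≤g x))) (map∈boxes f g f≤g xs)

allTuples-unique : ∀ n N → Unique (allTuples n N)
allTuples-unique zero    N = All.[] ∷ []
allTuples-unique (suc n) N rewrite concatMap-map≡cartesianProductWith Vec._∷_ (upTo (suc N)) (allTuples n N) =
  Unique.cartesianProductWith⁺ Vec._∷_ ∷-injective (Unique.upTo⁺ (suc N)) (allTuples-unique n N)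

allTuples-bounded : ∀ n N {v} → v ∈ allTuples n N → ∀ j → Vec.lookup v j ≤ N
allTuples-bounded (suc n) N {v} v∈ j
  with x , w , x∈ , w∈ , refl ← ∈-cartesianProductWith⁻ Vec._∷_ (upTo (suc N)) (allTuples n N)
         (subst (v ∈_) (concatMap-map≡cartesianProductWith Vec._∷_ (upTo (suc N)) (allTuples n N)) v∈)
  with j
... | zero  = ≤-pred (∈-upTo⁻ x∈)
... | suc j = allTuples-bounded n N w∈ j

module _ {P : Pred ℕ 0ℓ} (P? : Decidable P) where

  largestUpTo : ℕ → ℕ
  largestUpTo zero    = 0
  largestUpTo (suc n) with P? (suc n)
  ... | yes _ = suc n
  ... | no  _ = largestUpTo n

  largestUpTo-satisfies : P 0 → ∀ n → P (largestUpTo n)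
  largestUpTo-satisfies P0 zero    = P0
  largestUpTo-satisfies P0 (suc n) with P? (suc n)
  ... | yes P[n+1] = P[n+1]
  ... | no  _      = largestUpTo-satisfies P0 n

  largestUpTo-largest : ∀ {m n} → m ≤ n → P m → m ≤ largestUpTo n
  largestUpTo-largest {n = zero}  z≤n Pm = z≤n
  largestUpTo-largest {n = suc n} m≤n Pm with P? (suc n)
  ... | yes _ = m≤n
  ... | no ¬P[n+1] with m≤n⇒m<n∨m≡n m≤n
  ...   | inj₁ m<n+1 = largestUpTo-largest (≤-pred m<n+1) Pm
  ...   | inj₂ refl  = ⊥-elim (¬P[n+1] Pm)

T-does⇒ : ∀ {P : Set} (P? : Dec P) → T (does P?) → P
T-does⇒ (yes p) _ = p

T-not-does⇒¬ : ∀ {P : Set} (P? : Dec P) → T (not (does P?)) → ¬ P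
T-not-does⇒¬ (no ¬p) _ = ¬p

T-and⇒All : ∀ bs → T (and bs) → All T bs
T-and⇒All bs t = all⁺ id bs (subst (T ∘ and) (sym (map-id bs)) t)

module _ {k} (Γ : Fin k → Fin k → ℕ) (H : ℚ) (h : Fin k → ℕ) (adm : T (admissible Γ H h)) where

  private
    vanishesAt0 belowH : Fin k → Bool
    vanishesAt0 i = not (does (toℕ i ℕ.≟ 0)) ∨ (h i ≡ᵇ 0)
    belowH i = does (toℚ (h i) ℚ.≤? H)

    matchesΓ : Fin k → Fin k → Bool
    matchesΓ i j = does (i Fin.≟ j) ∨ (not (h i ≡ᵇ h j) ∧ (gcd (cOf Γ) ∣ h j - h i ∣ ≡ᵇ Γ i j))

    conjuncts : T (all vanishesAt0 (allFin k)) × T (all belowH (allFin k)) ×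
                T (and (concatMap (λ i → map (matchesΓ i) (allFin k)) (allFin k)))
    conjuncts with vanishes , rest ← Equivalence.to (T-∧ {all vanishesAt0 (allFin k)}) adm
              with below , matches ← Equivalence.to (T-∧ {all belowH (allFin k)}) rest
              = vanishes , below , matches

  admissible⇒h≡0 : ∀ i → toℕ i ≡ 0 → h i ≡ 0
  admissible⇒h≡0 i i≡0 with Equivalence.to (T-∨ {not (does (toℕ i ℕ.≟ 0))})
                               (All.lookup (all⁺ vanishesAt0 (allFin k) (proj₁ conjuncts)) (∈-allFin i))
  ... | inj₁ i≢0  = ⊥-elim (T-not-does⇒¬ (toℕ i ℕ.≟ 0) i≢0 i≡0)
  ... | inj₂ h≡ᵇ0 = ≡ᵇ⇒≡ (h i) 0 h≡ᵇ0

  admissible⇒≤H : ∀ i → toℚ (h i) ℚ.≤ H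
  admissible⇒≤H i = T-does⇒ (toℚ (h i) ℚ.≤? H)
    (All.lookup (all⁺ belowH (allFin k) (proj₁ (proj₂ conjuncts))) (∈-allFin i))

  admissible⇒Γ∣ : ∀ {i j} → i ≢ j → Γ i j ∣ ∣ h j - h i ∣
  admissible⇒Γ∣ {i} {j} i≢j with Equivalence.to (T-∨ {does (i Fin.≟ j)}) (All.lookup row-i (∈-allFin j))
    where
    row-i : All (T ∘ matchesΓ i) (allFin k)
    row-i = map⁻ (All.lookup (map⁻ (concat⁻ (T-and⇒All _ (proj₂ (proj₂ conjuncts))))) (∈-allFin i))
  ... | inj₁ i≡j   = ⊥-elim (i≢j (T-does⇒ (i Fin.≟ j) i≡j))
  ... | inj₂ gcd≡Γ = subst (_∣ ∣ h j - h i ∣) (≡ᵇ⇒≡ _ _ (proj₂ (Equivalence.to (T-∧ {not (h i ≡ᵇ h j)}) gcd≡Γ)))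
                       (gcd[m,n]∣n (cOf Γ) _)

module Counting {k} (Γ : Fin k → Fin k → ℕ) (sys : IsSystem k Γ) (H : ℚ) (0<H : 0ℚ ℚ.< H)
                (σ : Permutation′ k) (σ-fixes-0 : FixesZero σ) where

  Γσ : Fin k → Fin k → ℕ
  Γσ = permSys σ Γ

  σ-injective : ∀ {i j} → σ ⟨$⟩ʳ i ≡ σ ⟨$⟩ʳ j → i ≡ j
  σ-injective eq = trans (sym (inverseˡ σ)) (trans (cong (σ ⟨$⟩ˡ_) eq) (inverseˡ σ))

  Γσ-nonZero : ∀ {i j} → i Fin.< j → NonZero (Γσ i j)
  Γσ-nonZero i<j = >-nonZero (proj₁ (proj₁ sys _ _ (<⇒≢ i<j ∘ σ-injective)))

  instance
    γσ-nonZero : ∀ {i} → NonZero (gammaIdx Γσ i)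
    γσ-nonZero {i} = gammaIdx-nonZero Γσ i Γσ-nonZero

  N : ℕ
  N = ℤ.∣ ↥ H ∣

  -- ⌊H⌋; the search may stop at N since every natural number below H is at most N.
  F : ℕ
  F = largestUpTo (λ x → toℚ x ℚ.≤? H) N

  F≤H : toℚ F ℚ.≤ H
  F≤H = largestUpTo-satisfies (λ x → toℚ x ℚ.≤? H) (ℚ.<⇒≤ 0<H) N

  admissible? : (v : Vec ℕ k) → Dec (admissible Γ H (Vec.lookup v) ≡ true)
  admissible? v = admissible Γ H (Vec.lookup v) Data.Bool.≟ true

  admissibleTuples : List (Vec ℕ k)
  admissibleTuples = filter admissible? (allTuples k N)

  ∈-admissibleTuples⁻ : ∀ {v} → v ∈ admissibleTuples → T (admissible Γ H (Vec.lookup v))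
  ∈-admissibleTuples⁻ v∈ = Equivalence.from T-≡ (proj₂ (∈-filter⁻ admissible? {xs = allTuples k N} v∈))

  quotients : Vec ℕ k → List ℕ
  quotients v = map (λ i → Vec.lookup v (σ ⟨$⟩ʳ i) / gammaIdx Γσ i) (posIdx k)

  bounds : List ℕ
  bounds = map (λ i → F / gammaIdx Γσ i) (posIdx k)

  quotients∈boxes : ∀ {v} → v ∈ admissibleTuples → quotients v ∈ boxes bounds
  quotients∈boxes {v} v∈ = map∈boxes _ _ (λ i → /-monoˡ-≤ (gammaIdx Γσ i) (entry≤F (σ ⟨$⟩ʳ i))) (posIdx k)
    where
    entry≤F : ∀ j → Vec.lookup v j ≤ F
    entry≤F j = largestUpTo-largest (λ x → toℚ x ℚ.≤? H)
      (allTuples-bounded k N (proj₁ (∈-filter⁻ admissible? {xs = allTuples k N} v∈)) j)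
      (admissible⇒≤H Γ H (Vec.lookup v) (∈-admissibleTuples⁻ v∈) j)

  admissible⇒compatible : ∀ h → T (admissible Γ H h) → Compatible Γσ (h ∘ (σ ⟨$⟩ʳ_))
  admissible⇒compatible h adm l<i = admissible⇒Γ∣ Γ H h adm (<⇒≢ l<i ∘ σ-injective)

  quotients-injective : ∀ {v w} → v ∈ admissibleTuples → w ∈ admissibleTuples →
                        quotients v ≡ quotients w → v ≡ w
  quotients-injective {v} {w} v∈ w∈ eq = Pointwise-≡⇒≡ (ext λ j →
    subst (λ t → Vec.lookup v t ≡ Vec.lookup w t) (inverseʳ σ) (entries-eq (σ ⟨$⟩ˡ j)))
    where
    v-adm = ∈-admissibleTuples⁻ v∈
    w-adm = ∈-admissibleTuples⁻ w∈
    quotient-eq : ∀ i → Vec.lookup v (σ ⟨$⟩ʳ i) / gammaIdx Γσ i ≡ Vec.lookup w (σ ⟨$⟩ʳ i) / gammaIdx Γσ i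
    quotient-eq i with toℕ i ℕ.≟ 0
    ... | yes i≡0 = /-congˡ (trans (admissible⇒h≡0 Γ H (Vec.lookup v) v-adm _ (σ-fixes-0 i i≡0))
                                   (sym (admissible⇒h≡0 Γ H (Vec.lookup w) w-adm _ (σ-fixes-0 i i≡0))))
    ... | no  i≢0 = map≡map⇒≡ eq (∈-filter⁺ (λ i → ¬? (toℕ i ℕ.≟ 0)) (∈-allFin i) i≢0)
    entries-eq : ∀ i → Vec.lookup v (σ ⟨$⟩ʳ i) ≡ Vec.lookup w (σ ⟨$⟩ʳ i)
    entries-eq = compatible-≡-by-quotients Γσ Γσ-nonZero
      (admissible⇒compatible (Vec.lookup v) v-adm) (admissible⇒compatible (Vec.lookup w) w-adm) quotient-eq

  M≤∏ : M Γ H ≤ product (map (λ i → suc (F / gammaIdx Γσ i)) (posIdx k))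
  M≤∏ = begin
    length admissibleTuples              ≤⟨ length-≤-injectiveOn quotients
                                              (Unique.filter⁺ admissible? (allTuples-unique k N))
                                              quotients∈boxes quotients-injective ⟩
    length (boxes bounds)                ≡⟨ length-boxes bounds ⟩
    product (map suc bounds)             ≡⟨ cong product (map-∘ (posIdx k)) ⟨
    product (map (λ i → suc (F / gammaIdx Γσ i)) (posIdx k)) ∎
    where open ≤-Reasoning

proposition3p3 : (k : ℕ) → 2 Data.Nat.≤ k → (Γ : Fin k → Fin k → ℕ) → IsSystem k Γ → (H : ℚ) → 0ℚ < H → (σ : Permutation′ k) → FixesZero σ → (Data.Rational._/_ (+ M Γ H) 1) Data.Rational.≤ bound σ Γ H
proposition3p3 k _ Γ sys H 0<H σ σ-fixes-0 = ℚ.≤-trans (toℚ-mono-≤ M≤∏)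
  (toℚ-product-≤ _ _ (λ i → toℚ[1+m/n]≤divℕ+1 (gammaIdx Γσ i) F≤H) (posIdx k))
  where open Counting Γ sys H 0<H σ σ-fixes-0
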